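{- Let $n\ge 2$ and let $G_1,\dots,G_n$ be miserable games. Then their disjunctive sum $G=G_1+\dots+G_n$ is miserable. Moreover, a position $x=(x_1,\dots,x_n)$ of $G$ is a swap position of $G$ if and only if $x_i$ is a swap position of $G_i$ for every $i\in\{1,\dots,n\}$; and (for such $x$) $x$ is a $(1,0)$-position if and only if the number of indices $i$ for which $x_i$ is a $(1,0)$-position is odd.
   Context: A game is a two-player impartial game given by a directed acyclic graph whose vertices are positions and whose arcs are moves, such that from every position only finitely many positions are reachable. A position with no moves is terminal. $\operatorname{mex}(S)$ is the least non-negative integer not in $S$. The normal Sprague–Grundy function is $\mathcal{G}(x)=\operatorname{mex}\{\mathcal{G}(y): x\to y\}$ (so $0$ on terminal positions); the misère Sprague–Grundy function $\mathcal{G}^-$ satisfies $\mathcal{G}^-(x)=1$ for terminal $x$ and $\mathcal{G}^-(x)=\operatorname{mex}\{\mathcal{G}^-(y): x\to y\}$ otherwise. An $(i,j)$-position is a position $x$ with $\mathcal{G}(x)=i$, $\mathcal{G}^-(x)=j$, and $V_{i,j}$ the set of them; a swap position is a position in $V_{0,1}\cup V_{1,0}$. A position $x$ is movable to a set $W$ if there is a move from $x$ to some position of $W$. A game is miserable if every position $x$ satisfies at least one of: (a) $x$ is a swap position; (b) $x$ is not movable to $V_{0,1}\cup V_{1,0}$; (c) $x$ is movable to $V_{0,1}$ and to $V_{1,0}$. The disjunctive sum $G_1+\dots+G_n$ has positions $(x_1,\dots,x_n)$ with $x_i$ a position of $G_i$; a move consists of choosing one index $i$ and making a move in $G_i$ in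 coordinate $i$, leaving the others unchanged; $\mathcal{G}$ and $\mathcal{G}^-$ of the sum are computed in the sum itself. -}

module Defs where

open import Data.Nat using (ℕ; zero; suc; _≟_)
open import Data.Nat.DivMod using (_%_)
open import Data.Bool using (if_then_else_)
open import Data.Fin using (Fin; zero; suc)
open import Data.List using (List; []; _∷_; _++_; map; length; filter)
open import Data.List.Membership.Propositional using (_∈_; mapWith∈)
open import Data.List.Membership.Propositional.Properties using (∈-++⁻; ∈-map⁻)
open import Data.List.Membership.DecPropositional _≟_ using (_∈?_)
open import Data.List.Relation.Unary.Any using (here; there)
open import Data.Product using (Σ; ∃; _×_; _,_; proj₁; proj₂)
open import Data.Product.Relation.Unary.All using ()
open import Data.Sum using (_⊎_; inj₁; inj₂)
open import Data.Unit using (⊤; tt)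
open import Data.Vec.Functional using ()
open import Function using (_∘_)
open import Induction.WellFounded using (WellFounded; Acc; acc)
open import Relation.Binary.PropositionalEquality using (_≡_; refl)
open import Relation.Nullary using (¬_; Dec; does)
open import Relation.Nullary.Decidable using (_×-dec_)
open import Data.List.Base using (allFin)

-- mex : least natural number not occurring in the list.
-- (The mex of a list of length k is at most k, so k+1 steps of search suffice.)

mexFrom : ℕ → ℕ → List ℕ → ℕ
mexFrom zero     k l = k
mexFrom (suc f)  k l = if does (k ∈? l) then mexFrom f (suc k) l else k

mex : List ℕ → ℕ
mex l = mexFrom (suc (length l)) 0 l

-- Finite branching + well-foundedness = finitely many reachable
-- positions.

record Game : Set₁ where
  field
    Pos   : Set
    moves : Pos → List Pos
    wf    : WellFounded (λ y x → y ∈ moves x)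

open Game public

module _ (G : Game) where

  grundyAcc : (x : Pos G) → Acc (λ y x → y ∈ moves G x) x → ℕ
  grundyAcc x (acc rs) = mex (mapWith∈ (moves G x) (λ {y} p → grundyAcc y (rs p)))

  mexOrOne : List ℕ → ℕ
  mexOrOne []      = 1
  mexOrOne (a ∷ l) = mex (a ∷ l)

  misereAcc : (x : Pos G) → Acc (λ y x → y ∈ moves G x) x → ℕ
  misereAcc x (acc rs) = mexOrOne (mapWith∈ (moves G x) (λ {y} p → misereAcc y (rs p)))

grundy : (G : Game) → Pos G → ℕ
grundy G x = grundyAcc G x (wf G x)

misere : (G : Game) → Pos G → ℕ
misere G x = misereAcc G x (wf G x)

V : ℕ → ℕ → (G : Game) → Pos G → Set
V i j G x = grundy G x ≡ i × misere G x ≡ j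

V? : (i j : ℕ) (G : Game) (x : Pos G) → Dec (V i j G x)
V? i j G x = (grundy G x ≟ i) ×-dec (misere G x ≟ j)

Swap : (G : Game) → Pos G → Set
Swap G x = V 0 1 G x ⊎ V 1 0 G x

MovableTo : (G : Game) → Pos G → (Pos G → Set) → Set
MovableTo G x W = ∃ λ y → y ∈ moves G x × W y

Miserable : Game → Set
Miserable G = ∀ (x : Pos G) →
  Swap G x
  ⊎ (¬ MovableTo G x (Swap G)
  ⊎ (MovableTo G x (V 0 1 G) × MovableTo G x (V 1 0 G)))

_⊕_ : Game → Game → Game
G ⊕ H = record
  { Pos   = Pos G × Pos H
  ; moves = λ { (a , b) → map (λ a′ → (a′ , b)) (moves G a) ++ map (λ b′ → (a , b′)) (moves H b) }
  ; wf    = λ { (a , b) → accPair a (wf G a) b (wf H b) }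
  }
  where
  accPair : (a : Pos G) → Acc (λ y x → y ∈ moves G x) a →
            (b : Pos H) → Acc (λ y x → y ∈ moves H x) b →
            Acc (λ y x → y ∈ (map (λ a′ → (a′ , proj₂ x)) (moves G (proj₁ x))
                               ++ map (λ b′ → (proj₁ x , b′)) (moves H (proj₂ x)))) (a , b)
  accPair a (acc ra) b (acc rb) = acc λ {y} p → go y (∈-++⁻ (map (λ a′ → (a′ , b)) (moves G a)) p)
    where
    go : ∀ y → y ∈ map (λ a′ → (a′ , b)) (moves G a) ⊎ y ∈ map (λ b′ → (a , b′)) (moves H b) → _
    go y (inj₁ q) with ∈-map⁻ (λ a′ → (a′ , b)) q
    ... | a′ , m , refl = accPair a′ (ra m) b (acc rb)
    go y (inj₂ q) with ∈-map⁻ (λ b′ → (a , b′)) q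
    ... | b′ , m , refl = accPair a (acc ra) b′ (rb m)

Zero : Game
Zero = record { Pos = ⊤ ; moves = λ _ → [] ; wf = λ _ → acc λ () }

-- n-ary disjunctive sum G 0 + (G 1 + (... + (G (n-1) + Zero))).
-- Positions are nested tuples (x_0 , (x_1 , ... (x_{n-1} , tt))).
Sum : (n : ℕ) → (Fin n → Game) → Game
Sum zero    G = Zero
Sum (suc n) G = G zero ⊕ Sum n (G ∘ suc)

component : (n : ℕ) (G : Fin n → Game) → Pos (Sum n G) → (i : Fin n) → Pos (G i)
component (suc n) G (a , b) zero    = a
component (suc n) G (a , b) (suc i) = component n (G ∘ suc) b i

count10 : (n : ℕ) (G : Fin n → Game) → Pos (Sum n G) → ℕ
count10 n G x = length (filter (λ i → V? 1 0 (G i) (component n G x i)) (allFin n))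

module Submission where

-- In a miserable game every position is a swap position or satisfies G = G⁻:
-- conditions (b) and (c) make the options of x carry the same set of normal
-- values as of misère values, so the two mex computations agree.  For a sum
-- G ⊕ H one shows by induction on positions that (a , b) is a swap position
-- exactly when a and b are, using G(a , b) = 0 ⇔ G(a) = G(b) and
-- G(a , b) = 1 ⇔ G(a) = G(b) xor 1.  If a is not a swap position, the swap
-- options of (a , b) are the (a′ , b) with a′ a swap option of a, and their
-- types are those of a′ shifted by the type of b, so (b) or (c) is inherited
-- from a.  As swap positions have G ∈ {0, 1}, G of an all-swap position is the
-- parity of the number of its (1,0)-components; the n-ary statement follows
-- by induction on n.

open import Defs
open import Data.Empty using (⊥-elim)
open import Data.Fin using (Fin; zero; suc; toℕ)
open import Data.Fin.Properties using (pigeonhole; toℕ<n; ∀-cons-⇔)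
open import Data.List using (List; []; _∷_; length; map; filter; lookup; tabulate; allFin)
open import Data.List.Membership.Propositional using (_∈_; _∉_)
open import Data.List.Membership.Propositional.Properties
  using (∈-map⁺; ∈-map⁻; ∈-++⁺ˡ; ∈-++⁺ʳ; ∈-++⁻; mapWith∈-cong; mapWith∈≗map)
open import Data.List.Properties using (filter-accept; filter-reject; map-tabulate)
open import Data.List.Relation.Unary.Any using (here; index)
open import Data.List.Relation.Unary.Any.Properties using (lookup-index)
open import Data.Nat using (ℕ; zero; suc; _+_; _≤_; _<_; _≟_; z≤n; s≤s; NonZero)
open import Data.Nat.DivMod using (_%_; %-distribˡ-+; m%n%n≡m%n; m%n<n)
open import Data.Nat.Properties
  using (≤-<-connex; <-irrefl; <-cmp; +-identityʳ; +-suc; ≤-pred; m≤n⇒m<n∨m≡n;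
         n≤1⇒n≡0∨n≡1; n<1⇒n≡0; ≤-reflexive; 0≢1+n; suc-injective)
open import Data.List.Membership.DecPropositional _≟_ using (_∈?_)
open import Data.Product using (∃; _×_; _,_; proj₁; proj₂)
open import Data.Product.Function.NonDependent.Propositional using (_×-⇔_)
open import Data.Sum using (_⊎_; inj₁; inj₂; [_,_])
open import Data.Unit using (tt)
open import Function using (_∘_; id)
open import Function.Bundles using (_⇔_; mk⇔; Equivalence)
open import Function.Properties.Equivalence using () renaming (refl to ⇔-refl; trans to ⇔-trans)
open import Induction.WellFounded using (Acc; acc)
open import Relation.Binary.Definitions using (tri<; tri≈; tri>)
open import Relation.Binary.PropositionalEquality
  using (_≡_; _≢_; refl; sym; trans; cong; subst; module ≡-Reasoning)
open import Relation.Nullary using (¬_; Dec; yes; no)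
open import Relation.Nullary.Decidable using (_⊎-dec_)
open import Relation.Unary using (Pred; Decidable)

open Equivalence using (to; from)

below⊆⇒≤length : (l : List ℕ) (k : ℕ) → (∀ j → j < k → j ∈ l) → k ≤ length l
below⊆⇒≤length l k below∈ with ≤-<-connex k (length l)
... | inj₁ k≤len = k≤len
... | inj₂ len<k with pigeonhole len<k (λ i → index (below∈ (toℕ i) (toℕ<n i)))
... | i , j , i<j , same-index = ⊥-elim (<-irrefl toℕi≡toℕj i<j)
  where
  toℕi≡toℕj : toℕ i ≡ toℕ j
  toℕi≡toℕj = trans (lookup-index (below∈ (toℕ i) _))
                    (trans (cong (lookup l) same-index) (sym (lookup-index (below∈ (toℕ j) _))))

mexFrom-spec : (l : List ℕ) (fuel k : ℕ) → (∀ j → j < k → j ∈ l) →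
  (∀ j → j < mexFrom fuel k l → j ∈ l) × (mexFrom fuel k l ∉ l ⊎ mexFrom fuel k l ≡ k + fuel)
mexFrom-spec l zero k below∈ = below∈ , inj₂ (sym (+-identityʳ k))
mexFrom-spec l (suc fuel) k below∈ with k ∈? l
... | no k∉ = below∈ , inj₁ k∉
... | yes k∈ with mexFrom-spec l fuel (suc k) below-suc∈
  where
  below-suc∈ : ∀ j → j < suc k → j ∈ l
  below-suc∈ j j<1+k with m≤n⇒m<n∨m≡n (≤-pred j<1+k)
  ... | inj₁ j<k = below∈ j j<k
  ... | inj₂ refl = k∈
... | below , inj₁ ∉l = below , inj₁ ∉l
... | below , inj₂ ≡end = below , inj₂ (trans ≡end (sym (+-suc k fuel)))

<mex⇒∈ : (l : List ℕ) → ∀ j → j < mex l → j ∈ l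
<mex⇒∈ l = proj₁ (mexFrom-spec l (suc (length l)) 0 (λ _ ()))

-- If the search ran out of fuel, all of 0 , … , length l would lie in l.
mex∉ : (l : List ℕ) → mex l ∉ l
mex∉ l with mexFrom-spec l (suc (length l)) 0 (λ _ ())
... | _ , inj₁ ∉l = ∉l
... | below , inj₂ ≡end =
  ⊥-elim (<-irrefl refl (below⊆⇒≤length l (suc (length l)) (λ j j< → below j (subst (j <_) (sym ≡end) j<))))

mex-unique : (l : List ℕ) (k : ℕ) → k ∉ l → (∀ j → j < k → j ∈ l) → mex l ≡ k
mex-unique l k k∉ below∈ with <-cmp (mex l) k
... | tri< mex<k _ _ = ⊥-elim (mex∉ l (below∈ _ mex<k))
... | tri≈ _ mex≡k _ = mex≡k
... | tri> _ _ k<mex = ⊥-elim (k∉ (<mex⇒∈ l k k<mex))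

module _ (Γ : Game) where

  grundyAcc-irrelevant : ∀ x (p q : Acc (λ y x → y ∈ moves Γ x) x) → grundyAcc Γ x p ≡ grundyAcc Γ x q
  grundyAcc-irrelevant x (acc rs) (acc rs′) =
    cong mex (mapWith∈-cong (moves Γ x) _ _ (λ y∈ → grundyAcc-irrelevant _ (rs y∈) (rs′ y∈)))

  misereAcc-irrelevant : ∀ x (p q : Acc (λ y x → y ∈ moves Γ x) x) → misereAcc Γ x p ≡ misereAcc Γ x q
  misereAcc-irrelevant x (acc rs) (acc rs′) =
    cong (mexOrOne Γ) (mapWith∈-cong (moves Γ x) _ _ (λ y∈ → misereAcc-irrelevant _ (rs y∈) (rs′ y∈)))

  grundy-unfold : ∀ x → grundy Γ x ≡ mex (map (grundy Γ) (moves Γ x))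
  grundy-unfold x with wf Γ x
  ... | acc rs = cong mex (trans
    (mapWith∈-cong (moves Γ x) _ _ (λ y∈ → grundyAcc-irrelevant _ (rs y∈) (wf Γ _)))
    (mapWith∈≗map (grundy Γ) (moves Γ x)))

  misere-unfold : ∀ x → misere Γ x ≡ mexOrOne Γ (map (misere Γ) (moves Γ x))
  misere-unfold x with wf Γ x
  ... | acc rs = cong (mexOrOne Γ) (trans
    (mapWith∈-cong (moves Γ x) _ _ (λ y∈ → misereAcc-irrelevant _ (rs y∈) (wf Γ _)))
    (mapWith∈≗map (misere Γ) (moves Γ x)))

xor1 : ℕ → ℕ
xor1 0 = 1
xor1 1 = 0
xor1 (suc (suc n)) = suc (suc (xor1 n))

xor1-involutive : ∀ n → xor1 (xor1 n) ≡ n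
xor1-involutive 0 = refl
xor1-involutive 1 = refl
xor1-involutive (suc (suc n)) = cong (λ k → suc (suc k)) (xor1-involutive n)

xor1-≢ : ∀ n → xor1 n ≢ n
xor1-≢ 0 ()
xor1-≢ 1 ()
xor1-≢ (suc (suc n)) eq = xor1-≢ n (suc-injective (suc-injective eq))

≡xor1-sym : ∀ {m n} → m ≡ xor1 n → n ≡ xor1 m
≡xor1-sym {n = n} refl = sym (xor1-involutive n)

xor1-≤1 : ∀ {n} → n ≤ 1 → xor1 n ≤ 1
xor1-≤1 z≤n = s≤s z≤n
xor1-≤1 (s≤s z≤n) = z≤n

≤1⇒≡∨≡xor1 : ∀ {m n} → m ≤ 1 → n ≤ 1 → m ≡ n ⊎ m ≡ xor1 n
≤1⇒≡∨≡xor1 z≤n z≤n = inj₁ refl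
≤1⇒≡∨≡xor1 z≤n (s≤s z≤n) = inj₂ refl
≤1⇒≡∨≡xor1 (s≤s z≤n) z≤n = inj₂ refl
≤1⇒≡∨≡xor1 (s≤s z≤n) (s≤s z≤n) = inj₁ refl

xor1-squeeze : ∀ m n → m < xor1 n → n < xor1 m → m ≡ n
xor1-squeeze 0 0 _ _ = refl
xor1-squeeze 0 (suc n) _ (s≤s ())
xor1-squeeze 1 n _ ()
xor1-squeeze (suc (suc m)) 0 (s≤s ()) _
xor1-squeeze (suc (suc m)) 1 () _
xor1-squeeze (suc (suc m)) (suc (suc n)) (s≤s (s≤s m<)) (s≤s (s≤s n<)) =
  cong (λ k → suc (suc k)) (xor1-squeeze m n m< n<)

module MexValue (Γ : Game) (f : Pos Γ → ℕ) {x : Pos Γ} (f-mex : f x ≡ mex (map f (moves Γ x))) where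

  option-≢ : ∀ {y} → y ∈ moves Γ x → f y ≢ f x
  option-≢ y∈ fy≡fx = mex∉ _ (subst (_∈ map f (moves Γ x)) (trans fy≡fx f-mex) (∈-map⁺ f y∈))

  option-below : ∀ {j} → j < f x → MovableTo Γ x (λ y → f y ≡ j)
  option-below {j} j< with ∈-map⁻ f (<mex⇒∈ _ j (subst (j <_) f-mex j<))
  ... | y , y∈ , j≡fy = y , y∈ , sym j≡fy

  value : ∀ k → (∀ {y} → y ∈ moves Γ x → f y ≢ k) →
          (∀ {j} → j < k → MovableTo Γ x (λ y → f y ≡ j)) → f x ≡ k
  value k no-k below = trans f-mex (mex-unique _ k k∉ below∈)
    where
    k∉ : k ∉ map f (moves Γ x)
    k∉ k∈ with ∈-map⁻ f k∈
    ... | _ , y∈ , k≡fy = no-k y∈ (sym k≡fy)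
    below∈ : ∀ j → j < k → j ∈ map f (moves Γ x)
    below∈ j j< with below j<
    ... | _ , y∈ , fy≡j = subst (_∈ map f (moves Γ x)) fy≡j (∈-map⁺ f y∈)


Terminal : (Γ : Game) → Pos Γ → Set
Terminal Γ x = moves Γ x ≡ []

SwapOrEqual : (Γ : Game) → Pos Γ → Set
SwapOrEqual Γ x = Swap Γ x ⊎ grundy Γ x ≡ misere Γ x

-- Conditions (b) and (c) of miserability; Miserable Γ unfolds to ∀ x → MiserableAt Γ x.
SwapBalanced : (Γ : Game) → Pos Γ → Set
SwapBalanced Γ x = ¬ MovableTo Γ x (Swap Γ) ⊎ (MovableTo Γ x (V 0 1 Γ) × MovableTo Γ x (V 1 0 Γ))

MiserableAt : (Γ : Game) → Pos Γ → Set
MiserableAt Γ x = Swap Γ x ⊎ SwapBalanced Γ x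

module Values (Γ : Game) where

  terminal-or-option : ∀ x → Terminal Γ x ⊎ ∃ (_∈ moves Γ x)
  terminal-or-option x with moves Γ x
  ... | []    = inj₁ refl
  ... | y ∷ _ = inj₂ (y , here refl)

  terminal⇒V01 : ∀ {x} → Terminal Γ x → V 0 1 Γ x
  terminal⇒V01 {x} t = trans (grundy-unfold Γ x) (cong (mex ∘ map (grundy Γ)) t)
                     , trans (misere-unfold Γ x) (cong (mexOrOne Γ ∘ map (misere Γ)) t)

  misere-nonterminal : ∀ {x y} → y ∈ moves Γ x → misere Γ x ≡ mex (map (misere Γ) (moves Γ x))
  misere-nonterminal {x} y∈ = trans (misere-unfold Γ x) (mexOrOne-nonempty (∈-map⁺ (misere Γ) y∈))
    where
    mexOrOne-nonempty : ∀ {l : List ℕ} {v} → v ∈ l → mexOrOne Γ l ≡ mex l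
    mexOrOne-nonempty {_ ∷ _} _ = refl

  module Grundy (x : Pos Γ) = MexValue Γ (grundy Γ) (grundy-unfold Γ x)
  module Misere {x y : Pos Γ} (y∈ : y ∈ moves Γ x) = MexValue Γ (misere Γ) (misere-nonterminal y∈)

  swap? : ∀ x → Dec (Swap Γ x)
  swap? x = V? 0 1 Γ x ⊎-dec V? 1 0 Γ x

  swap-grundy≤1 : ∀ {x} → Swap Γ x → grundy Γ x ≤ 1
  swap-grundy≤1 (inj₁ (g≡0 , _)) = subst (_≤ 1) (sym g≡0) z≤n
  swap-grundy≤1 (inj₂ (g≡1 , _)) = subst (_≤ 1) (sym g≡1) (s≤s z≤n)

  swap-misere : ∀ {x} → Swap Γ x → misere Γ x ≡ xor1 (grundy Γ x)
  swap-misere (inj₁ (g≡0 , m≡1)) = trans m≡1 (cong xor1 (sym g≡0))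
  swap-misere (inj₂ (g≡1 , m≡0)) = trans m≡0 (cong xor1 (sym g≡1))

  swap-grundy : ∀ {x} → Swap Γ x → grundy Γ x ≡ xor1 (misere Γ x)
  swap-grundy = ≡xor1-sym ∘ swap-misere

  swap⇒V : ∀ {x k} → Swap Γ x → grundy Γ x ≡ k → V k (xor1 k) Γ x
  swap⇒V sw g≡k = g≡k , trans (swap-misere sw) (cong xor1 g≡k)

  swap⇒grundy≢misere : ∀ {x} → Swap Γ x → grundy Γ x ≢ misere Γ x
  swap⇒grundy≢misere {x} sw g≡m = xor1-≢ (misere Γ x) (trans (sym (swap-grundy sw)) g≡m)

  non-swap⇒option : ∀ {x} → ¬ Swap Γ x → ∃ (_∈ moves Γ x)
  non-swap⇒option {x} ns with terminal-or-option x
  ... | inj₁ t = ⊥-elim (ns (inj₁ (terminal⇒V01 t)))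
  ... | inj₂ option = option

  module _ {x : Pos Γ} where

    swap-partner : ∀ {y} → SwapBalanced Γ x → y ∈ moves Γ x → Swap Γ y →
                   MovableTo Γ x (λ z → Swap Γ z × grundy Γ z ≡ misere Γ y)
    swap-partner (inj₁ no-swap) y∈ sy = ⊥-elim (no-swap (_ , y∈ , sy))
    swap-partner (inj₂ (_ , (z , z∈ , v))) _ (inj₁ (_ , m≡1)) = z , z∈ , inj₂ v , trans (proj₁ v) (sym m≡1)
    swap-partner (inj₂ ((z , z∈ , v) , _)) _ (inj₂ (_ , m≡0)) = z , z∈ , inj₁ v , trans (proj₁ v) (sym m≡0)

    grundy≡misere-if-balanced : ∀ {y} → y ∈ moves Γ x → SwapBalanced Γ x →
      (∀ {y} → y ∈ moves Γ x → SwapOrEqual Γ y) → grundy Γ x ≡ misere Γ x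
    grundy≡misere-if-balanced y∈ bal options = sym (Misere.value y∈ (grundy Γ x) misere≢ misere-below)
      where
      grundy-of : ∀ {y} → y ∈ moves Γ x → MovableTo Γ x (λ z → grundy Γ z ≡ misere Γ y)
      grundy-of y∈ with options y∈
      ... | inj₁ sy = let z , z∈ , _ , gz≡my = swap-partner bal y∈ sy in z , z∈ , gz≡my
      ... | inj₂ g≡m = _ , y∈ , g≡m
      misere-of : ∀ {y} → y ∈ moves Γ x → MovableTo Γ x (λ z → misere Γ z ≡ grundy Γ y)
      misere-of y∈ with options y∈
      ... | inj₁ sy = let z , z∈ , sz , gz≡my = swap-partner bal y∈ sy
                      in z , z∈ , trans (swap-misere sz) (trans (cong xor1 gz≡my) (sym (swap-grundy sy)))
      ... | inj₂ g≡m = _ , y∈ , sym g≡m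
      misere≢ : ∀ {y} → y ∈ moves Γ x → misere Γ y ≢ grundy Γ x
      misere≢ y∈ my≡gx = let _ , z∈ , gz≡my = grundy-of y∈ in Grundy.option-≢ x z∈ (trans gz≡my my≡gx)
      misere-below : ∀ {j} → j < grundy Γ x → MovableTo Γ x (λ z → misere Γ z ≡ j)
      misere-below j< = let _ , y∈ , gy≡j = Grundy.option-below x j<
                            z , z∈ , mz≡gy = misere-of y∈
                        in z , z∈ , trans mz≡gy gy≡j

  miserable⇒swapOrEqual : Miserable Γ → ∀ x → SwapOrEqual Γ x
  miserable⇒swapOrEqual mis x = go x (wf Γ x)
    where
    go : ∀ x → Acc (λ y x → y ∈ moves Γ x) x → SwapOrEqual Γ x
    go x (acc rs) with mis x | terminal-or-option x
    ... | inj₁ sw  | _             = inj₁ sw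
    ... | inj₂ _   | inj₁ t        = inj₁ (inj₁ (terminal⇒V01 t))
    ... | inj₂ bal | inj₂ (_ , y∈) = inj₂ (grundy≡misere-if-balanced y∈ bal (λ z∈ → go _ (rs z∈)))

  module _ {s : Pos Γ} where

    option-of-swap : ∀ {y} → Swap Γ s → y ∈ moves Γ s → SwapOrEqual Γ y → grundy Γ y ≤ 1 → Swap Γ y
    option-of-swap _ _ (inj₁ sy) _ = sy
    option-of-swap ss y∈ (inj₂ g≡m) g≤1 with ≤1⇒≡∨≡xor1 g≤1 (swap-grundy≤1 ss)
    ... | inj₁ gy≡gs = ⊥-elim (Grundy.option-≢ s y∈ gy≡gs)
    ... | inj₂ gy≡xor = ⊥-elim (Misere.option-≢ y∈ y∈ (trans (sym g≡m) (trans gy≡xor (sym (swap-misere ss)))))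

    option-of-other-type : ∀ {y} → Swap Γ s → y ∈ moves Γ s →
                           (∀ {y} → y ∈ moves Γ s → SwapOrEqual Γ y) →
                           MovableTo Γ s (λ z → grundy Γ z ≡ xor1 (grundy Γ s))
    option-of-other-type (inj₂ (g≡1 , _)) _ _ =
      let z , z∈ , gz≡0 = Grundy.option-below s (subst (0 <_) (sym g≡1) (s≤s z≤n))
      in z , z∈ , trans gz≡0 (cong xor1 (sym g≡1))
    option-of-other-type (inj₁ (g≡0 , m≡1)) y∈ options
      with Misere.option-below y∈ (subst (0 <_) (sym m≡1) (s≤s z≤n))
    ... | z , z∈ , mz≡0 with options z∈
    ...   | inj₁ sz = z , z∈ , trans (swap-grundy sz) (trans (cong xor1 mz≡0) (cong xor1 (sym g≡0)))
    ...   | inj₂ gz≡mz = ⊥-elim (Grundy.option-≢ s z∈ (trans gz≡mz (trans mz≡0 (sym g≡0))))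

  swap-if-small-misere : ∀ {y} → SwapOrEqual Γ y × (grundy Γ y ≤ 1 → Swap Γ y) → misere Γ y ≤ 1 → Swap Γ y
  swap-if-small-misere (inj₁ sy , _) _ = sy
  swap-if-small-misere (inj₂ g≡m , swap-if-small) m≤1 = swap-if-small (subst (_≤ 1) (sym g≡m) m≤1)

  module _ {x : Pos Γ} where

    swap-from-options : grundy Γ x ≤ 1 →
      (∀ {y} → y ∈ moves Γ x → SwapOrEqual Γ y × (grundy Γ y ≤ 1 → Swap Γ y)) →
      (grundy Γ x ≡ 0 → ∃ (_∈ moves Γ x) → MovableTo Γ x (λ y → grundy Γ y ≡ 1)) →
      Swap Γ x
    swap-from-options g≤1 options one-option with n≤1⇒n≡0∨n≡1 g≤1 | terminal-or-option x
    ... | inj₁ _   | inj₁ t = inj₁ (terminal⇒V01 t)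
    ... | inj₁ g≡0 | inj₂ option@(_ , y∈) = inj₁ (g≡0 , Misere.value y∈ 1 no-one below-one)
      where
      no-one : ∀ {z} → z ∈ moves Γ x → misere Γ z ≢ 1
      no-one z∈ mz≡1 = Grundy.option-≢ x z∈ (begin
        grundy Γ _            ≡⟨ swap-grundy (swap-if-small-misere (options z∈) (≤-reflexive mz≡1)) ⟩
        xor1 (misere Γ _)     ≡⟨ cong xor1 mz≡1 ⟩
        0                     ≡⟨ g≡0 ⟨
        grundy Γ x            ∎)
        where open ≡-Reasoning
      below-one : ∀ {j} → j < 1 → MovableTo Γ x (λ z → misere Γ z ≡ j)
      below-one j<1 with one-option g≡0 option
      ... | z , z∈ , gz≡1 = z , z∈ , (begin
        misere Γ z            ≡⟨ swap-misere (proj₂ (options z∈) (≤-reflexive gz≡1)) ⟩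
        xor1 (grundy Γ z)     ≡⟨ cong xor1 gz≡1 ⟩
        0                     ≡⟨ n<1⇒n≡0 j<1 ⟨
        _                     ∎)
        where open ≡-Reasoning
    ... | inj₂ g≡1 | _ with Grundy.option-below x (subst (0 <_) (sym g≡1) (s≤s z≤n))
    ...   | _ , y∈ , _ = inj₂ (g≡1 , Misere.value y∈ 0 no-zero (λ ()))
      where
      no-zero : ∀ {z} → z ∈ moves Γ x → misere Γ z ≢ 0
      no-zero z∈ mz≡0 = Grundy.option-≢ x z∈ (begin
        grundy Γ _            ≡⟨ swap-grundy (swap-if-small-misere (options z∈) (subst (_≤ 1) (sym mz≡0) z≤n)) ⟩
        xor1 (misere Γ _)     ≡⟨ cong xor1 mz≡0 ⟩
        1                     ≡⟨ g≡1 ⟨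
        grundy Γ x            ∎)
        where open ≡-Reasoning

module _ (G H : Game) where

  private
    S : Game
    S = G ⊕ H

    AccS : Pos S → Set
    AccS = Acc (λ y x → y ∈ moves S x)

    module 𝔾 = Values G
    module ℍ = Values H
    module 𝕊 = Values S

  data ⊕-Option (a : Pos G) (b : Pos H) : Pos S → Set where
    left  : ∀ {a′} → a′ ∈ moves G a → ⊕-Option a b (a′ , b)
    right : ∀ {b′} → b′ ∈ moves H b → ⊕-Option a b (a , b′)

  ⊕-option : ∀ {a b y} → y ∈ moves S (a , b) → ⊕-Option a b y
  ⊕-option {a} {b} y∈ with ∈-++⁻ (map (λ a′ → (a′ , b)) (moves G a)) y∈
  ... | inj₁ y∈ˡ with ∈-map⁻ (λ a′ → (a′ , b)) y∈ˡ
  ...   | _ , a′∈ , refl = left a′∈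
  ⊕-option {a} {b} y∈ | inj₂ y∈ʳ with ∈-map⁻ (λ b′ → (a , b′)) y∈ʳ
  ...   | _ , b′∈ , refl = right b′∈

  ⊕-left : ∀ {a a′ b} → a′ ∈ moves G a → (a′ , b) ∈ moves S (a , b)
  ⊕-left {b = b} a′∈ = ∈-++⁺ˡ (∈-map⁺ (λ a′ → (a′ , b)) a′∈)

  ⊕-right : ∀ {a b b′} → b′ ∈ moves H b → (a , b′) ∈ moves S (a , b)
  ⊕-right {a} {b} b′∈ = ∈-++⁺ʳ (map (λ a′ → (a′ , b)) (moves G a)) (∈-map⁺ (λ b′ → (a , b′)) b′∈)

  -- Takes the ⇐ direction of grundy-⊕≡0 on options as a hypothesis, so that
  -- the inductive proof of grundy-⊕≡0 can use it.
  zero-option-of-⊕ : ∀ {a b} →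
    (∀ {a′ b′} → (a′ , b′) ∈ moves S (a , b) → grundy G a′ ≡ grundy H b′ → grundy S (a′ , b′) ≡ 0) →
    grundy G a ≢ grundy H b → MovableTo S (a , b) (λ y → grundy S y ≡ 0)
  zero-option-of-⊕ {a} {b} equal⇒zero ga≢gb with <-cmp (grundy G a) (grundy H b)
  ... | tri< ga<gb _ _ = let b′ , b′∈ , gb′≡ga = ℍ.Grundy.option-below b ga<gb
                         in (a , b′) , ⊕-right b′∈ , equal⇒zero (⊕-right b′∈) (sym gb′≡ga)
  ... | tri≈ _ ga≡gb _ = ⊥-elim (ga≢gb ga≡gb)
  ... | tri> _ _ gb<ga = let a′ , a′∈ , ga′≡gb = 𝔾.Grundy.option-below a gb<ga
                         in (a′ , b) , ⊕-left a′∈ , equal⇒zero (⊕-left a′∈) ga′≡gb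

  grundy-⊕≡0-acc : ∀ a b → AccS (a , b) → grundy S (a , b) ≡ 0 ⇔ grundy G a ≡ grundy H b
  grundy-⊕≡0-acc a b (acc rs) = mk⇔ zero⇒equal equal⇒zero
    where
    ih : ∀ {a′ b′} → (a′ , b′) ∈ moves S (a , b) →
         grundy S (a′ , b′) ≡ 0 ⇔ grundy G a′ ≡ grundy H b′
    ih y∈ = grundy-⊕≡0-acc _ _ (rs y∈)

    equal⇒zero : grundy G a ≡ grundy H b → grundy S (a , b) ≡ 0
    equal⇒zero ga≡gb = 𝕊.Grundy.value (a , b) 0 no-zero (λ ())
      where
      no-zero : ∀ {y} → y ∈ moves S (a , b) → grundy S y ≢ 0
      no-zero y∈ gy≡0 with ⊕-option y∈
      ... | left a′∈  = 𝔾.Grundy.option-≢ a a′∈ (trans (to (ih y∈) gy≡0) (sym ga≡gb))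
      ... | right b′∈ = ℍ.Grundy.option-≢ b b′∈ (trans (sym (to (ih y∈) gy≡0)) ga≡gb)

    zero⇒equal : grundy S (a , b) ≡ 0 → grundy G a ≡ grundy H b
    zero⇒equal gS≡0 with grundy G a ≟ grundy H b
    ... | yes ga≡gb = ga≡gb
    ... | no ga≢gb =
      let _ , y∈ , gy≡0 = zero-option-of-⊕ (from ∘ ih) ga≢gb
      in ⊥-elim (𝕊.Grundy.option-≢ (a , b) y∈ (trans gy≡0 (sym gS≡0)))

  grundy-⊕≡0 : ∀ {a b} → grundy S (a , b) ≡ 0 ⇔ grundy G a ≡ grundy H b
  grundy-⊕≡0 {a} {b} = grundy-⊕≡0-acc a b (wf S (a , b))

  grundy-⊕≡1-acc : ∀ a b → AccS (a , b) → grundy S (a , b) ≡ 1 ⇔ grundy G a ≡ xor1 (grundy H b)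
  grundy-⊕≡1-acc a b (acc rs) = mk⇔ one⇒xor1 xor1⇒one
    where
    ih : ∀ {a′ b′} → (a′ , b′) ∈ moves S (a , b) →
         grundy S (a′ , b′) ≡ 1 ⇔ grundy G a′ ≡ xor1 (grundy H b′)
    ih y∈ = grundy-⊕≡1-acc _ _ (rs y∈)

    xor1⇒one : grundy G a ≡ xor1 (grundy H b) → grundy S (a , b) ≡ 1
    xor1⇒one ga≡xgb = 𝕊.Grundy.value (a , b) 1 no-one zero-below
      where
      no-one : ∀ {y} → y ∈ moves S (a , b) → grundy S y ≢ 1
      no-one y∈ gy≡1 with ⊕-option y∈
      ... | left a′∈  = 𝔾.Grundy.option-≢ a a′∈ (trans (to (ih y∈) gy≡1) (sym ga≡xgb))
      ... | right b′∈ = ℍ.Grundy.option-≢ b b′∈ (trans (≡xor1-sym (to (ih y∈) gy≡1)) (sym (≡xor1-sym ga≡xgb)))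
      zero-below : ∀ {j} → j < 1 → MovableTo S (a , b) (λ y → grundy S y ≡ j)
      zero-below j<1 rewrite n<1⇒n≡0 j<1 =
        zero-option-of-⊕ (λ _ → from grundy-⊕≡0) (λ ga≡gb → xor1-≢ (grundy H b) (trans (sym ga≡xgb) ga≡gb))

    one⇒xor1 : grundy S (a , b) ≡ 1 → grundy G a ≡ xor1 (grundy H b)
    one⇒xor1 gS≡1 with grundy G a ≟ xor1 (grundy H b)
    ... | yes ga≡xgb = ga≡xgb
    ... | no ga≢xgb with <-cmp (xor1 (grundy H b)) (grundy G a) | <-cmp (xor1 (grundy G a)) (grundy H b)
    ... | tri≈ _ xgb≡ga _ | _ = ⊥-elim (ga≢xgb (sym xgb≡ga))
    ... | _ | tri≈ _ xga≡gb _ = ⊥-elim (ga≢xgb (≡xor1-sym (sym xga≡gb)))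
    ... | tri< xgb<ga _ _ | _ =
      let a′ , a′∈ , ga′≡xgb = 𝔾.Grundy.option-below a xgb<ga
      in ⊥-elim (𝕊.Grundy.option-≢ (a , b) (⊕-left a′∈)
                   (trans (from (ih (⊕-left a′∈)) ga′≡xgb) (sym gS≡1)))
    ... | _ | tri< xga<gb _ _ =
      let b′ , b′∈ , gb′≡xga = ℍ.Grundy.option-below b xga<gb
      in ⊥-elim (𝕊.Grundy.option-≢ (a , b) (⊕-right b′∈)
                   (trans (from (ih (⊕-right b′∈)) (≡xor1-sym gb′≡xga)) (sym gS≡1)))
    ... | tri> _ _ ga<xgb | tri> _ _ gb<xga =
      ⊥-elim (0≢1+n (trans (sym (from grundy-⊕≡0 (xor1-squeeze _ _ ga<xgb gb<xga))) gS≡1))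

  grundy-⊕≡1 : ∀ {a b} → grundy S (a , b) ≡ 1 ⇔ grundy G a ≡ xor1 (grundy H b)
  grundy-⊕≡1 {a} {b} = grundy-⊕≡1-acc a b (wf S (a , b))

  grundy-⊕≤1⇒ˡ : ∀ {a b} → grundy S (a , b) ≤ 1 → grundy H b ≤ 1 → grundy G a ≤ 1
  grundy-⊕≤1⇒ˡ gS≤1 gb≤1 with n≤1⇒n≡0∨n≡1 gS≤1
  ... | inj₁ gS≡0 = subst (_≤ 1) (sym (to grundy-⊕≡0 gS≡0)) gb≤1
  ... | inj₂ gS≡1 = subst (_≤ 1) (sym (to grundy-⊕≡1 gS≡1)) (xor1-≤1 gb≤1)

  grundy-⊕≤1⇒ʳ : ∀ {a b} → grundy S (a , b) ≤ 1 → grundy G a ≤ 1 → grundy H b ≤ 1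
  grundy-⊕≤1⇒ʳ gS≤1 ga≤1 with n≤1⇒n≡0∨n≡1 gS≤1
  ... | inj₁ gS≡0 = subst (_≤ 1) (to grundy-⊕≡0 gS≡0) ga≤1
  ... | inj₂ gS≡1 = subst (_≤ 1) (sym (≡xor1-sym (to grundy-⊕≡1 gS≡1))) (xor1-≤1 ga≤1)

  grundy-⊕-bits : ∀ {a b} → grundy G a ≤ 1 → grundy H b ≤ 1 →
                  grundy S (a , b) ≡ (grundy G a + grundy H b) % 2
  grundy-⊕-bits ga≤1 gb≤1 with n≤1⇒n≡0∨n≡1 ga≤1 | n≤1⇒n≡0∨n≡1 gb≤1
  ... | inj₁ ga≡0 | inj₁ gb≡0 rewrite ga≡0 | gb≡0 = from grundy-⊕≡0 (trans ga≡0 (sym gb≡0))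
  ... | inj₁ ga≡0 | inj₂ gb≡1 rewrite ga≡0 | gb≡1 = from grundy-⊕≡1 (trans ga≡0 (cong xor1 (sym gb≡1)))
  ... | inj₂ ga≡1 | inj₁ gb≡0 rewrite ga≡1 | gb≡0 = from grundy-⊕≡1 (trans ga≡1 (cong xor1 (sym gb≡0)))
  ... | inj₂ ga≡1 | inj₂ gb≡1 rewrite ga≡1 | gb≡1 = from grundy-⊕≡0 (trans ga≡1 (sym gb≡1))

  record ⊕-Invariant (a : Pos G) (b : Pos H) : Set where
    field
      miserableAt : MiserableAt S (a , b)
      swapOrEqual : SwapOrEqual S (a , b)
      swap⇒swaps  : Swap S (a , b) → Swap G a × Swap H b
      swaps⇒swap  : Swap G a → Swap H b → Swap S (a , b)

  OptionsInvariant : Pos G → Pos H → Set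
  OptionsInvariant a b = ∀ {a′ b′} → (a′ , b′) ∈ moves S (a , b) → ⊕-Invariant a′ b′

  open ⊕-Invariant

  module _ {a : Pos G} {b : Pos H} (inv : OptionsInvariant a b) where

    swap-option-of-⊕ : MovableTo S (a , b) (Swap S) →
      (MovableTo G a (Swap G) × Swap H b) ⊎ (Swap G a × MovableTo H b (Swap H))
    swap-option-of-⊕ (_ , y∈ , sy) with ⊕-option y∈
    ... | left a′∈  = let sa′ , sb = swap⇒swaps (inv y∈) sy in inj₁ ((_ , a′∈ , sa′) , sb)
    ... | right b′∈ = let sa , sb′ = swap⇒swaps (inv y∈) sy in inj₂ (sa , (_ , b′∈ , sb′))

    swap-option-⊕ˡ : ∀ {a′ k} → Swap H b → a′ ∈ moves G a → Swap G a′ → grundy S (a′ , b) ≡ k →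
                     MovableTo S (a , b) (V k (xor1 k) S)
    swap-option-⊕ˡ sb a′∈ sa′ g≡k = _ , ⊕-left a′∈ , 𝕊.swap⇒V (swaps⇒swap (inv (⊕-left a′∈)) sa′ sb) g≡k

    swap-option-⊕ʳ : ∀ {b′ k} → Swap G a → b′ ∈ moves H b → Swap H b′ → grundy S (a , b′) ≡ k →
                     MovableTo S (a , b) (V k (xor1 k) S)
    swap-option-⊕ʳ sa b′∈ sb′ g≡k = _ , ⊕-right b′∈ , 𝕊.swap⇒V (swaps⇒swap (inv (⊕-right b′∈)) sa sb′) g≡k

    both-types-⊕ˡ : Swap H b → MovableTo G a (V 0 1 G) → MovableTo G a (V 1 0 G) →
                    MovableTo S (a , b) (V 0 1 S) × MovableTo S (a , b) (V 1 0 S)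
    both-types-⊕ˡ sb (_ , a₀∈ , v₀) (_ , a₁∈ , v₁) with n≤1⇒n≡0∨n≡1 (ℍ.swap-grundy≤1 sb)
    ... | inj₁ gb≡0 = swap-option-⊕ˡ sb a₀∈ (inj₁ v₀) (from grundy-⊕≡0 (trans (proj₁ v₀) (sym gb≡0)))
                    , swap-option-⊕ˡ sb a₁∈ (inj₂ v₁) (from grundy-⊕≡1 (trans (proj₁ v₁) (cong xor1 (sym gb≡0))))
    ... | inj₂ gb≡1 = swap-option-⊕ˡ sb a₁∈ (inj₂ v₁) (from grundy-⊕≡0 (trans (proj₁ v₁) (sym gb≡1)))
                    , swap-option-⊕ˡ sb a₀∈ (inj₁ v₀) (from grundy-⊕≡1 (trans (proj₁ v₀) (cong xor1 (sym gb≡1))))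

    both-types-⊕ʳ : Swap G a → MovableTo H b (V 0 1 H) → MovableTo H b (V 1 0 H) →
                    MovableTo S (a , b) (V 0 1 S) × MovableTo S (a , b) (V 1 0 S)
    both-types-⊕ʳ sa (_ , b₀∈ , v₀) (_ , b₁∈ , v₁) with n≤1⇒n≡0∨n≡1 (𝔾.swap-grundy≤1 sa)
    ... | inj₁ ga≡0 = swap-option-⊕ʳ sa b₀∈ (inj₁ v₀) (from grundy-⊕≡0 (trans ga≡0 (sym (proj₁ v₀))))
                    , swap-option-⊕ʳ sa b₁∈ (inj₂ v₁) (from grundy-⊕≡1 (trans ga≡0 (cong xor1 (sym (proj₁ v₁)))))
    ... | inj₂ ga≡1 = swap-option-⊕ʳ sa b₁∈ (inj₂ v₁) (from grundy-⊕≡0 (trans ga≡1 (sym (proj₁ v₁))))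
                    , swap-option-⊕ʳ sa b₀∈ (inj₁ v₀) (from grundy-⊕≡1 (trans ga≡1 (cong xor1 (sym (proj₁ v₀)))))

  module _ (misG : Miserable G) (misH : Miserable H) where

    module _ {a : Pos G} {b : Pos H} (inv : OptionsInvariant a b) where

      balanced-⊕ˡ : ¬ Swap G a → SwapBalanced S (a , b)
      balanced-⊕ˡ na with ℍ.swap? b | misG a
      ... | no nb  | _                    = inj₁ ([ nb ∘ proj₂ , na ∘ proj₁ ] ∘ swap-option-of-⊕ inv)
      ... | yes _  | inj₁ sa              = ⊥-elim (na sa)
      ... | yes _  | inj₂ (inj₁ no-swap)  = inj₁ ([ no-swap ∘ proj₁ , na ∘ proj₁ ] ∘ swap-option-of-⊕ inv)
      ... | yes sb | inj₂ (inj₂ (v₀ , v₁)) = inj₂ (both-types-⊕ˡ inv sb v₀ v₁)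

      balanced-⊕ʳ : ¬ Swap H b → SwapBalanced S (a , b)
      balanced-⊕ʳ nb with 𝔾.swap? a | misH b
      ... | no na  | _                    = inj₁ ([ nb ∘ proj₂ , na ∘ proj₁ ] ∘ swap-option-of-⊕ inv)
      ... | yes _  | inj₁ sb              = ⊥-elim (nb sb)
      ... | yes _  | inj₂ (inj₁ no-swap)  = inj₁ ([ nb ∘ proj₂ , no-swap ∘ proj₂ ] ∘ swap-option-of-⊕ inv)
      ... | yes sa | inj₂ (inj₂ (v₀ , v₁)) = inj₂ (both-types-⊕ʳ inv sa v₀ v₁)

      ⊕-invariant-non-swap : ¬ Swap G a ⊎ ¬ Swap H b → ⊕-Invariant a b
      ⊕-invariant-non-swap non-swap = record
        { miserableAt = inj₂ balanced
        ; swapOrEqual = inj₂ g≡m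
        ; swap⇒swaps  = λ s → ⊥-elim (𝕊.swap⇒grundy≢misere s g≡m)
        ; swaps⇒swap  = λ sa sb → ⊥-elim ([ (λ na → na sa) , (λ nb → nb sb) ] non-swap)
        }
        where
        balanced : SwapBalanced S (a , b)
        balanced = [ balanced-⊕ˡ , balanced-⊕ʳ ] non-swap
        option : ∃ (_∈ moves S (a , b))
        option = [ (λ na → _ , ⊕-left (proj₂ (𝔾.non-swap⇒option na)))
                 , (λ nb → _ , ⊕-right (proj₂ (ℍ.non-swap⇒option nb))) ] non-swap
        g≡m : grundy S (a , b) ≡ misere S (a , b)
        g≡m = 𝕊.grundy≡misere-if-balanced (proj₂ option) balanced (λ y∈ → swapOrEqual (inv y∈))

      swap-⊕ : Swap G a → Swap H b → Swap S (a , b)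
      swap-⊕ sa sb = 𝕊.swap-from-options gS≤1 options one-option
        where
        ga≤1 = 𝔾.swap-grundy≤1 sa
        gb≤1 = ℍ.swap-grundy≤1 sb
        gS≤1 : grundy S (a , b) ≤ 1
        gS≤1 = subst (_≤ 1) (sym (grundy-⊕-bits ga≤1 gb≤1)) (≤-pred (m%n<n (grundy G a + grundy H b) 2))
        small⇒swap : ∀ {y} → y ∈ moves S (a , b) → grundy S y ≤ 1 → Swap S y
        small⇒swap y∈ g≤1 with ⊕-option y∈
        ... | left a′∈ = swaps⇒swap (inv y∈)
          (𝔾.option-of-swap sa a′∈ (𝔾.miserable⇒swapOrEqual misG _) (grundy-⊕≤1⇒ˡ g≤1 gb≤1)) sb
        ... | right b′∈ = swaps⇒swap (inv y∈) sa
          (ℍ.option-of-swap sb b′∈ (ℍ.miserable⇒swapOrEqual misH _) (grundy-⊕≤1⇒ʳ g≤1 ga≤1))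
        options : ∀ {y} → y ∈ moves S (a , b) → SwapOrEqual S y × (grundy S y ≤ 1 → Swap S y)
        options y∈ = swapOrEqual (inv y∈) , small⇒swap y∈
        one-option : grundy S (a , b) ≡ 0 → ∃ (_∈ moves S (a , b)) →
                     MovableTo S (a , b) (λ y → grundy S y ≡ 1)
        one-option gS≡0 (_ , y∈) with ⊕-option y∈
        ... | left a′∈ =
          let _ , a″∈ , ga″≡xga = 𝔾.option-of-other-type sa a′∈ (λ _ → 𝔾.miserable⇒swapOrEqual misG _)
          in _ , ⊕-left a″∈ , from grundy-⊕≡1 (trans ga″≡xga (cong xor1 (to grundy-⊕≡0 gS≡0)))
        ... | right b′∈ =
          let _ , b″∈ , gb″≡xgb = ℍ.option-of-other-type sb b′∈ (λ _ → ℍ.miserable⇒swapOrEqual misH _)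
          in _ , ⊕-right b″∈ , from grundy-⊕≡1 (trans (to grundy-⊕≡0 gS≡0) (≡xor1-sym gb″≡xgb))

    ⊕-invariant-step : ∀ {a b} → OptionsInvariant a b → ⊕-Invariant a b
    ⊕-invariant-step {a} {b} inv with 𝔾.swap? a | ℍ.swap? b
    ... | yes sa | yes sb = record
      { miserableAt = inj₁ s ; swapOrEqual = inj₁ s ; swap⇒swaps = λ _ → sa , sb ; swaps⇒swap = λ _ _ → s }
      where s = swap-⊕ inv sa sb
    ... | no na | _     = ⊕-invariant-non-swap inv (inj₁ na)
    ... | _     | no nb = ⊕-invariant-non-swap inv (inj₂ nb)

    ⊕-invariant : ∀ a b → AccS (a , b) → ⊕-Invariant a b
    ⊕-invariant a b (acc rs) = ⊕-invariant-step (λ y∈ → ⊕-invariant _ _ (rs y∈))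

    ⊕-miserable : Miserable S
    ⊕-miserable (a , b) = miserableAt (⊕-invariant a b (wf S (a , b)))

    ⊕-swap⇔ : ∀ {a b} → Swap S (a , b) ⇔ (Swap G a × Swap H b)
    ⊕-swap⇔ {a} {b} = mk⇔ (swap⇒swaps invariant) (λ (sa , sb) → swaps⇒swap invariant sa sb)
      where invariant = ⊕-invariant a b (wf S (a , b))

length-filter-map : ∀ {a b p} {A : Set a} {B : Set b} {P : Pred B p} (P? : Decidable P) (f : A → B) xs →
  length (filter P? (map f xs)) ≡ length (filter (P? ∘ f) xs)
length-filter-map P? f [] = refl
length-filter-map P? f (x ∷ xs) with P? (f x)
... | yes _ = cong suc (length-filter-map P? f xs)
... | no _  = length-filter-map P? f xs

[m+n%d]%d≡[m+n]%d : ∀ m n d .{{_ : NonZero d}} → (m + n % d) % d ≡ (m + n) % d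
[m+n%d]%d≡[m+n]%d m n d = begin
  (m + n % d) % d         ≡⟨ %-distribˡ-+ m (n % d) d ⟩
  (m % d + n % d % d) % d ≡⟨ cong (λ k → (m % d + k) % d) (m%n%n≡m%n n d) ⟩
  (m % d + n % d) % d     ≡⟨ %-distribˡ-+ m n d ⟨
  (m + n) % d             ∎
  where open ≡-Reasoning

count10-suc : ∀ n (G : Fin (suc n) → Game) {a b} → Swap (G zero) a →
  count10 (suc n) G (a , b) ≡ grundy (G zero) a + count10 n (G ∘ suc) b
count10-suc n G {a} {b} sa = step (P? zero)
  where
  open ≡-Reasoning
  P? : Decidable (λ i → V 1 0 (G i) (component (suc n) G (a , b) i))
  P? i = V? 1 0 (G i) (component (suc n) G (a , b) i)
  c = count10 n (G ∘ suc) b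
  tail : length (filter P? (tabulate suc)) ≡ c
  tail = trans (cong (length ∘ filter P?) (sym (map-tabulate id suc))) (length-filter-map P? suc (allFin n))
  step : Dec (V 1 0 (G zero) a) → count10 (suc n) G (a , b) ≡ grundy (G zero) a + c
  step (yes v10) = begin
    count10 (suc n) G (a , b)               ≡⟨ cong length (filter-accept P? v10) ⟩
    suc (length (filter P? (tabulate suc))) ≡⟨ cong suc tail ⟩
    1 + c                                   ≡⟨ cong (_+ c) (proj₁ v10) ⟨
    grundy (G zero) a + c                   ∎
  step (no ¬v10) = begin
    count10 (suc n) G (a , b)         ≡⟨ cong length (filter-reject P? ¬v10) ⟩
    length (filter P? (tabulate suc)) ≡⟨ tail ⟩
    0 + c                             ≡⟨ cong (_+ c) (proj₁ v01) ⟨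
    grundy (G zero) a + c             ∎
    where
    v01 : V 0 1 (G zero) a
    v01 = [ id , ⊥-elim ∘ ¬v10 ] sa

record SumProperties (n : ℕ) (G : Fin n → Game) : Set where
  field
    miserable : Miserable (Sum n G)
    swap⇔     : ∀ x → Swap (Sum n G) x ⇔ (∀ i → Swap (G i) (component n G x i))
    parity    : ∀ x → Swap (Sum n G) x → grundy (Sum n G) x ≡ count10 n G x % 2

sum-properties : ∀ n (G : Fin n → Game) → (∀ i → Miserable (G i)) → SumProperties n G
sum-properties zero G _ = record
  { miserable = λ _ → inj₁ terminal-swap
  ; swap⇔     = λ _ → mk⇔ (λ _ ()) (λ _ → terminal-swap)
  ; parity    = λ _ _ → refl
  }
  where
  terminal-swap : Swap Zero tt
  terminal-swap = inj₁ (refl , refl)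
sum-properties (suc n) G mis = record
  { miserable = ⊕-miserable G₀ Gs (mis zero) (miserable rest)
  ; swap⇔     = λ (a , b) → ⇔-trans swap⇔-⊕ (⇔-trans (⇔-refl ×-⇔ swap⇔ rest b) ∀-cons-⇔)
  ; parity    = λ (a , b) → parity-⊕ a b
  }
  where
  open SumProperties
  G₀ = G zero
  Gs = Sum n (G ∘ suc)
  rest = sum-properties n (G ∘ suc) (mis ∘ suc)

  swap⇔-⊕ : ∀ {a b} → Swap (G₀ ⊕ Gs) (a , b) ⇔ (Swap G₀ a × Swap Gs b)
  swap⇔-⊕ = ⊕-swap⇔ G₀ Gs (mis zero) (miserable rest)

  parity-⊕ : ∀ a b → Swap (G₀ ⊕ Gs) (a , b) → grundy (G₀ ⊕ Gs) (a , b) ≡ count10 (suc n) G (a , b) % 2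
  parity-⊕ a b s = begin
    grundy (G₀ ⊕ Gs) (a , b)      ≡⟨ grundy-⊕-bits G₀ Gs (Values.swap-grundy≤1 G₀ sa) (Values.swap-grundy≤1 Gs sb) ⟩
    (ga + grundy Gs b) % 2        ≡⟨ cong (λ k → (ga + k) % 2) (parity rest b sb) ⟩
    (ga + c % 2) % 2              ≡⟨ [m+n%d]%d≡[m+n]%d ga c 2 ⟩
    (ga + c) % 2                  ≡⟨ cong (_% 2) (count10-suc n G sa) ⟨
    count10 (suc n) G (a , b) % 2 ∎
    where
    open ≡-Reasoning
    ga = grundy G₀ a
    c = count10 n (G ∘ suc) b
    sa = proj₁ (to swap⇔-⊕ s)
    sb = proj₂ (to swap⇔-⊕ s)

corollary5p4 : (n : ℕ) → 2 ≤ n → (G : Fin n → Game) → (∀ i → Miserable (G i)) →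
    Miserable (Sum n G)
    × ((x : Pos (Sum n G)) →
    (Swap (Sum n G) x ⇔ (∀ (i : Fin n) → Swap (G i) (component n G x i)))
    × (Swap (Sum n G) x → (V 1 0 (Sum n G) x ⇔ (count10 n G x % 2 ≡ 1))))
corollary5p4 n _ G mis = miserable , λ x → swap⇔ x , λ s →
  mk⇔ (λ v10 → trans (sym (parity x s)) (proj₁ v10))
      (λ odd → Values.swap⇒V (Sum n G) s (trans (parity x s) odd))
  where open SumProperties (sum-properties n G mis)
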